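{- For $n\ge1$ let $P_n(x,z)=\sum_{\sigma\in\mathcal{S}_n}x^{\overrightarrow{des}_E(\sigma)}z^{\chi(\sigma_1\text{ even})}$. Then (1) $P_1(x,z)=1$ and $P_2(x,z)=1+z$; (2) for all $n\ge1$, $P_{2n+1}(x,z)=\Theta_{2n}(P_{2n}(x,z))$; (3) for all $n\ge1$, $P_{2n+2}(x,z)=\Omega_{2n+1}(P_{2n+1}(x,z))$, where $\Theta_{2n}$ is the linear operator on polynomials in $x,z$ (applied to polynomials of degree at most 1 in $z$) sending $z^0x^k\mapsto (n+k+1)z^0x^k+(n-k)z^0x^{k+1}$ and $z^1x^k\mapsto (n+k+1)z^1x^k+z^0x^{k+1}+(n-k-1)z^1x^{k+1}$, and $\Omega_{2n+1}$ is the linear operator sending $z^0x^k\mapsto (n+k+1)z^0x^k+z^1x^k+(n-k)z^0x^{k+1}$ and $z^1x^k\mapsto (n+k+2)z^1x^k+(n-k)z^1x^{k+1}$.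
   Context: $\mathcal{S}_n$ denotes the set of permutations $\sigma=\sigma_1\cdots\sigma_n$ of $\{1,\dots,n\}$. $\overrightarrow{des}_E(\sigma)$ is the number of indices $i\in\{1,\dots,n-1\}$ with $\sigma_i>\sigma_{i+1}$ and $\sigma_{i+1}$ even. $\chi(\sigma_1\text{ even})$ is $1$ if $\sigma_1$ is even and $0$ otherwise. -}

module Defs where

open import Data.Nat using (ℕ; zero; suc; _<ᵇ_)
open import Data.Nat.Properties using (_≟_)
open import Data.Bool using (Bool; true; false; _∧_; if_then_else_)
open import Data.Fin using (Fin)
open import Relation.Nullary using (yes; no)
open import Relation.Binary.PropositionalEquality using (_≡_)
import Data.Fin as F
open import Data.List using (List; []; _∷_; map; concatMap; upTo; filter; foldr)
open import Data.List.Relation.Unary.Unique.DecPropositional _≟_ using (unique?)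
open import Data.Integer using (ℤ; +_) renaming (_+_ to _+ℤ_; _*_ to _*ℤ_; _-_ to _-ℤ_)

even : ℕ → Bool
even zero = true
even (suc zero) = false
even (suc (suc n)) = even n

words : ℕ → ℕ → List (List ℕ)
words m zero = [] ∷ []
words m (suc l) = concatMap (λ a → map (a ∷_) (words m l)) (map suc (upTo m))

-- S_n : the permutations σ₁⋯σₙ of {1,…,n}, i.e. words of length n over
-- {1,…,n} with pairwise distinct letters (each listed exactly once)
S : ℕ → List (List ℕ)
S n = filter unique? (words n n)

desE : List ℕ → ℕ
desE (a ∷ b ∷ rest) = (if (b <ᵇ a) ∧ even b then 1 else 0) Data.Nat.+ desE (b ∷ rest)
desE _ = 0

chi : List ℕ → Fin 2
chi (a ∷ _) = if even a then F.suc F.zero else F.zero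
chi [] = F.zero

-- Polynomials in x,z of degree ≤ 1 in z, with integer coefficients,
-- represented by their coefficient function: p k j = [z^j x^k] p.
Poly : Set
Poly = ℕ → Fin 2 → ℤ

_≈P_ : Poly → Poly → Set
p ≈P q = ∀ k j → p k j ≡ q k j

0P : Poly
0P _ _ = + 0

_+P_ : Poly → Poly → Poly
(p +P q) k j = p k j +ℤ q k j

mono : ℕ → Fin 2 → Poly
mono k j k' j' with k ≟ k' | j F.≟ j'
... | yes _ | yes _ = + 1
... | _ | _ = + 0

P : ℕ → Poly
P n = foldr (λ σ acc → mono (desE σ) (chi σ) +P acc) 0P (S n)

oneP : Poly
oneP = mono 0 F.zero

onePlusZ : Poly
onePlusZ = mono 0 F.zero +P mono 0 (F.suc F.zero)

-- Θ_{2n}: the linear operator with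
--   z⁰xᵏ ↦ (n+k+1) z⁰xᵏ + (n−k) z⁰xᵏ⁺¹
--   z¹xᵏ ↦ (n+k+1) z¹xᵏ + z⁰xᵏ⁺¹ + (n−k−1) z¹xᵏ⁺¹
-- written coefficientwise (coefficients in ℤ, so n−k is a true difference).
Θ : ℕ → Poly → Poly
Θ n p zero F.zero = (+ n +ℤ + 0 +ℤ + 1) *ℤ p zero F.zero
Θ n p zero (F.suc F.zero) = (+ n +ℤ + 0 +ℤ + 1) *ℤ p zero (F.suc F.zero)
Θ n p (suc k) F.zero =
  ((+ n +ℤ + suc k +ℤ + 1) *ℤ p (suc k) F.zero)
  +ℤ ((+ n -ℤ + k) *ℤ p k F.zero)
  +ℤ p k (F.suc F.zero)
Θ n p (suc k) (F.suc F.zero) =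
  ((+ n +ℤ + suc k +ℤ + 1) *ℤ p (suc k) (F.suc F.zero))
  +ℤ ((+ n -ℤ + k -ℤ + 1) *ℤ p k (F.suc F.zero))

-- Ω_{2n+1}: the linear operator with
--   z⁰xᵏ ↦ (n+k+1) z⁰xᵏ + z¹xᵏ + (n−k) z⁰xᵏ⁺¹
--   z¹xᵏ ↦ (n+k+2) z¹xᵏ + (n−k) z¹xᵏ⁺¹
Ω : ℕ → Poly → Poly
Ω n p zero F.zero = (+ n +ℤ + 0 +ℤ + 1) *ℤ p zero F.zero
Ω n p zero (F.suc F.zero) =
  p zero F.zero +ℤ ((+ n +ℤ + 0 +ℤ + 2) *ℤ p zero (F.suc F.zero))
Ω n p (suc k) F.zero =
  ((+ n +ℤ + suc k +ℤ + 1) *ℤ p (suc k) F.zero)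
  +ℤ ((+ n -ℤ + k) *ℤ p k F.zero)
Ω n p (suc k) (F.suc F.zero) =
  p (suc k) F.zero
  +ℤ ((+ n +ℤ + suc k +ℤ + 2) *ℤ p (suc k) (F.suc F.zero))
  +ℤ ((+ n -ℤ + k) *ℤ p k (F.suc F.zero))

-- Every permutation of {1,…,m+1} arises exactly once by inserting m+1 into a
-- permutation τ of {1,…,m}. Write x^d z^c for the monomial of τ and A for the number
-- of ascents of τ onto an even letter. Inserting m+1 in front gives x^(c+d) z^χ(m+1 even);
-- inserting it right after a letter raises desE by one exactly when the next letter is
-- the top of such an ascent, and changes nothing otherwise. So τ contributes
--   x^(c+d) z^χ(m+1 even) + (m − A) x^d z^c + A x^(d+1) z^c
-- to P_{m+1}. Each even letter of τ except the first is the top of an ascent or the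
-- bottom of a descent, whence c + A + d = ⌊m/2⌋; with this relation the contribution is
-- Θ_{2n}(x^d z^c) when m = 2n and Ω_{2n+1}(x^d z^c) when m = 2n+1, and both operators
-- are linear.

module Submission where

open import Defs
open import Data.Nat using (ℕ; _+_; _*_; _≥_)
open import Data.Product using (_×_; _,_; proj₁; proj₂)

open import Algebra.Bundles using (CommutativeMonoid; AbelianGroup)
import Algebra.Construct.Pointwise as Pointwise
import Algebra.Properties.CommutativeSemigroup as CommSemigroupProperties
open import Data.Bool using (Bool; true; false; if_then_else_; _∧_)
open import Data.Fin using (Fin; toℕ) renaming (zero to #0; suc to fsuc)
import Data.Fin.Properties as Fin
open import Data.Integer as ℤ using (ℤ; +_) renaming (_+_ to _+ℤ_; _*_ to _*ℤ_; _-_ to _-ℤ_)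
import Data.Integer.Properties as ℤ
open import Data.Integer.Tactic.RingSolver using (solve-∀)
open import Data.List using (List; []; _∷_; foldr; map; concatMap; length; upTo; _++_)
open import Data.List.Membership.Propositional using (_∈_; _∉_; find; lose)
open import Data.List.Membership.Propositional.Properties
  using (∈-map⁺; ∈-map⁻; map∷⁻; ∈-concatMap⁺; ∈-concatMap⁻; ∈-upTo⁺; ∈-upTo⁻; ∈-filter⁺; ∈-filter⁻)
open import Data.List.Membership.Propositional.Properties.WithK using (unique∧set⇒bag)
open import Data.List.Relation.Binary.BagAndSetEquality using (∼bag⇒↭)
open import Data.List.Relation.Binary.Permutation.Propositional
  using (_↭_; ↭-refl; ↭-trans; ↭-sym; ↭-prep; ↭-swap; ↭⇒↭ₛ; ↭⇒↭ₛ′)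
import Data.List.Relation.Binary.Permutation.Propositional.Properties as ↭
import Data.List.Relation.Binary.Permutation.Setoid.Properties as ↭ₛ
import Data.List.Properties as List
open import Data.List.Relation.Unary.All as All using (All; []; _∷_)
open import Data.List.Relation.Unary.Any using (Any; here; there)
open import Data.List.Relation.Unary.AllPairs using ([]; _∷_)
open import Data.List.Relation.Unary.Unique.Propositional using (Unique)
import Data.List.Relation.Unary.Unique.Propositional.Properties as Unique
open import Data.Nat using (zero; suc; _≤_; _<_; s≤s; z≤n; _<ᵇ_; ⌊_/2⌋)
open import Data.Nat.ListAction using (sum)
open import Data.Nat.ListAction.Properties using (sum-↭)
import Data.Nat.Properties as ℕ
open import Data.Nat.Properties using (_≟_)
open import Data.List.Membership.DecPropositional _≟_ using (_∈?_)
open import Data.List.Relation.Unary.Unique.DecPropositional _≟_ using (unique?)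
open import Function using (_∘_)
open import Function.Bundles using (mk⇔)
open import Relation.Binary.Bundles using (Setoid)
import Relation.Binary.Reasoning.Setoid as SetoidReasoning
open import Relation.Binary.Definitions using (tri<; tri≈; tri>)
open import Relation.Binary.PropositionalEquality
  using (_≡_; _≢_; refl; sym; trans; cong; cong₂; subst; subst₂; setoid)
open import Relation.Nullary using (Dec; yes; no; contradiction)
open import Relation.Nullary.Reflects using (ofʸ; ofⁿ)

open import Algebra.Properties.Group (AbelianGroup.group ℤ.+-0-abelianGroup)
  using () renaming (identityˡ-unique to ℤ-identityˡ-unique)
open CommSemigroupProperties ℕ.+-commutativeSemigroup using () renaming (interchange to +-interchange)

-- Inserting a letter into a word

insertions : ℕ → List ℕ → List (List ℕ)
insertions x []      = (x ∷ []) ∷ []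
insertions x (a ∷ τ) = (x ∷ a ∷ τ) ∷ map (a ∷_) (insertions x τ)

remove : ℕ → List ℕ → List ℕ
remove x []      = []
remove x (a ∷ σ) with a ≟ x
... | yes _ = σ
... | no _  = a ∷ remove x σ

∈-insertions⇒↭ : ∀ {x σ} τ → σ ∈ insertions x τ → σ ↭ x ∷ τ
∈-insertions⇒↭ []      (here refl) = ↭-refl
∈-insertions⇒↭ (a ∷ τ) (here refl) = ↭-refl
∈-insertions⇒↭ (a ∷ τ) (there σ∈) with σ′ , σ′∈ , refl ← map∷⁻ σ∈ =
  ↭-trans (↭-prep a (∈-insertions⇒↭ τ σ′∈)) (↭-swap a _ ↭-refl)

∷∈insertions : ∀ x τ → x ∷ τ ∈ insertions x τ
∷∈insertions x []      = here refl
∷∈insertions x (a ∷ τ) = here refl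

∈-insertions-remove : ∀ {x} σ → x ∈ σ → σ ∈ insertions x (remove x σ)
∈-insertions-remove {x} (a ∷ σ) x∈ with a ≟ x | x∈
... | yes refl | _         = ∷∈insertions a σ
... | no a≢x   | here refl = contradiction refl a≢x
... | no a≢x   | there x∈σ = there (∈-map⁺ (a ∷_) (∈-insertions-remove σ x∈σ))

remove-head : ∀ x σ → remove x (x ∷ σ) ≡ σ
remove-head x σ with x ≟ x
... | yes _  = refl
... | no x≢x = contradiction refl x≢x

remove-insertions : ∀ {x σ} τ → x ∉ τ → σ ∈ insertions x τ → remove x σ ≡ τ
remove-insertions {x} []      _   (here refl) = remove-head x []
remove-insertions {x} (a ∷ τ) _   (here refl) = remove-head x (a ∷ τ)
remove-insertions {x} (a ∷ τ) x∉τ (there σ∈)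
  with σ′ , σ′∈ , refl ← map∷⁻ σ∈ | a ≟ x
... | yes refl = contradiction (here refl) x∉τ
... | no _     = cong (a ∷_) (remove-insertions τ (x∉τ ∘ there) σ′∈)

∈⇒↭-remove : ∀ {x σ} → x ∈ σ → σ ↭ x ∷ remove x σ
∈⇒↭-remove {σ = σ} x∈σ = ∈-insertions⇒↭ (remove _ σ) (∈-insertions-remove σ x∈σ)

insertions-unique : ∀ {x} τ → x ∉ τ → Unique (insertions x τ)
insertions-unique []      _   = [] ∷ []
insertions-unique (a ∷ τ) x∉τ =
  All.tabulate head≢ ∷ Unique.map⁺ List.∷-injectiveʳ (insertions-unique τ (x∉τ ∘ there))
  where
  head≢ : ∀ {σ} → σ ∈ map (a ∷_) (insertions _ τ) → _ ≢ σ
  head≢ σ∈ eq with _ , _ , refl ← map∷⁻ σ∈ = x∉τ (here (List.∷-injectiveˡ eq))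

concatMap-unique : ∀ {A B : Set} (f : A → List B) {xs} → Unique xs →
  (∀ {a} → a ∈ xs → Unique (f a)) →
  (∀ {a a′ b} → a ∈ xs → a′ ∈ xs → b ∈ f a → b ∈ f a′ → a ≡ a′) →
  Unique (concatMap f xs)
concatMap-unique f {[]}     _           _        _        = []
concatMap-unique f {a ∷ xs} (a∉ ∷ uxs) f-unique disjoint =
  Unique.++⁺ (f-unique (here refl))
    (concatMap-unique f uxs (f-unique ∘ there) λ a∈ a′∈ → disjoint (there a∈) (there a′∈))
    λ (b∈fa , b∈rest) →
      let a′ , a′∈ , b∈fa′ = find (∈-concatMap⁻ f {xs = xs} b∈rest)
      in All.lookup a∉ a′∈ (disjoint (here refl) (there a′∈) b∈fa b∈fa′)

-- Permutations as distinct words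

InRange : ℕ → ℕ → Set
InRange m a = 1 ≤ a × a ≤ m

DistinctIn : ℕ → List ℕ → Set
DistinctIn m σ = Unique σ × All (InRange m) σ

∈-letters⁻ : ∀ {m a} → a ∈ map suc (upTo m) → InRange m a
∈-letters⁻ a∈ with i , i∈ , refl ← ∈-map⁻ suc a∈ = s≤s z≤n , ∈-upTo⁻ i∈

∈-letters⁺ : ∀ {m a} → InRange m a → a ∈ map suc (upTo m)
∈-letters⁺ {a = suc i} (_ , i<m) = ∈-map⁺ suc (∈-upTo⁺ i<m)

∈-words⁻ : ∀ m l {w} → w ∈ words m l → length w ≡ l × All (InRange m) w
∈-words⁻ m zero    (here refl) = refl , []
∈-words⁻ m (suc l) w∈
  with a , a∈ , w∈′ ← find (∈-concatMap⁻ (λ a → map (a ∷_) (words m l))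
                                           {xs = map suc (upTo m)} w∈)
  with w′ , w′∈ , refl ← map∷⁻ w∈′
  with |w′| , w′-in ← ∈-words⁻ m l w′∈
  = cong suc |w′| , ∈-letters⁻ a∈ ∷ w′-in

∈-words⁺ : ∀ m {w} → All (InRange m) w → w ∈ words m (length w)
∈-words⁺ m []             = here refl
∈-words⁺ m {a ∷ w} (a-in ∷ w-in) =
  ∈-concatMap⁺ (λ a → map (a ∷_) (words m (length w)))
    (lose (∈-letters⁺ a-in) (∈-map⁺ (a ∷_) (∈-words⁺ m w-in)))

words-unique : ∀ m l → Unique (words m l)
words-unique m zero    = [] ∷ []
words-unique m (suc l) =
  concatMap-unique (λ a → map (a ∷_) (words m l)) (Unique.map⁺ ℕ.suc-injective (Unique.upTo⁺ m))
    (λ _ → Unique.map⁺ List.∷-injectiveʳ (words-unique m l))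
    λ _ _ → same-head
  where
  same-head : ∀ {a a′ w ws ws′} → w ∈ map (a ∷_) ws → w ∈ map (a′ ∷_) ws′ → a ≡ a′
  same-head w∈ w∈′ with _ , _ , refl ← map∷⁻ w∈ | _ , _ , refl ← map∷⁻ w∈′ = refl

∈-S⁻ : ∀ m {σ} → σ ∈ S m → DistinctIn m σ × length σ ≡ m
∈-S⁻ m σ∈ with σ∈words , σ-unique ← ∈-filter⁻ unique? {xs = words m m} σ∈ =
  let |σ| , σ-in = ∈-words⁻ m m σ∈words in (σ-unique , σ-in) , |σ|

∈-S⁺ : ∀ {m σ} → DistinctIn m σ → length σ ≡ m → σ ∈ S m
∈-S⁺ {m} (σ-unique , σ-in) refl = ∈-filter⁺ unique? (∈-words⁺ m σ-in) σ-unique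

S-unique : ∀ m → Unique (S m)
S-unique m = Unique.filter⁺ unique? (words-unique m m)

DistinctIn-resp-↭ : ∀ {m σ σ′} → σ ↭ σ′ → DistinctIn m σ → DistinctIn m σ′
DistinctIn-resp-↭ σ↭σ′ (σ-unique , σ-in) =
  ↭ₛ.Unique-resp-↭ (setoid ℕ) (↭⇒↭ₛ σ↭σ′) σ-unique , ↭.All-resp-↭ σ↭σ′ σ-in

suc∉ : ∀ {m τ} → All (InRange m) τ → suc m ∉ τ
suc∉ τ-in m+1∈τ = ℕ.<-irrefl refl (proj₂ (All.lookup τ-in m+1∈τ))

InRange-restrict : ∀ {m τ} → All (InRange (suc m)) τ → suc m ∉ τ → All (InRange m) τ
InRange-restrict []                  _ = []
InRange-restrict ((1≤a , a≤m+1) ∷ τ-in) m+1∉ =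
  (1≤a , ℕ.≤-pred (ℕ.≤∧≢⇒< a≤m+1 (m+1∉ ∘ here ∘ sym)))
  ∷ InRange-restrict τ-in (m+1∉ ∘ there)

DistinctIn-∷⁺ : ∀ {m τ} → DistinctIn m τ → DistinctIn (suc m) (suc m ∷ τ)
DistinctIn-∷⁺ (τ-unique , τ-in) =
  All.tabulate (λ a∈ eq → suc∉ τ-in (subst (_∈ _) (sym eq) a∈)) ∷ τ-unique ,
  (s≤s z≤n , ℕ.≤-refl) ∷ All.map (λ (1≤a , a≤m) → 1≤a , ℕ.m≤n⇒m≤1+n a≤m) τ-in

DistinctIn-∷⁻ : ∀ {m τ} → DistinctIn (suc m) (suc m ∷ τ) → DistinctIn m τ
DistinctIn-∷⁻ (m+1∉ ∷ τ-unique , _ ∷ τ-in) =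
  τ-unique , InRange-restrict τ-in (Unique.Unique[x∷xs]⇒x∉xs (m+1∉ ∷ τ-unique))

DistinctIn⇒length≤ : ∀ m {σ} → DistinctIn m σ → length σ ≤ m
DistinctIn⇒length≤ zero    {[]}    _                       = z≤n
DistinctIn⇒length≤ zero    {a ∷ σ} (_ , (1≤a , a≤0) ∷ _) =
  contradiction (ℕ.≤-trans 1≤a a≤0) λ ()
DistinctIn⇒length≤ (suc m) {σ} (σ-unique , σ-in) with suc m ∈? σ
... | no m+1∉σ =
  ℕ.m≤n⇒m≤1+n (DistinctIn⇒length≤ m (σ-unique , InRange-restrict σ-in m+1∉σ))
... | yes m+1∈σ = subst (_≤ suc m) (sym (↭.↭-length σ↭))
  (s≤s (DistinctIn⇒length≤ m (DistinctIn-∷⁻ (DistinctIn-resp-↭ σ↭ (σ-unique , σ-in)))))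
  where σ↭ = ∈⇒↭-remove m+1∈σ

max∈ : ∀ {m σ} → DistinctIn (suc m) σ → length σ ≡ suc m → suc m ∈ σ
max∈ {m} {σ} (σ-unique , σ-in) |σ| with suc m ∈? σ
... | yes m+1∈σ = m+1∈σ
... | no m+1∉σ  =
  contradiction (subst (_≤ m) |σ| (DistinctIn⇒length≤ m (σ-unique , InRange-restrict σ-in m+1∉σ)))
                (ℕ.<-irrefl refl)

∈-S-suc⁻ : ∀ m {σ} → σ ∈ S (suc m) → Any (λ τ → σ ∈ insertions (suc m) τ) (S m)
∈-S-suc⁻ m {σ} σ∈ =
  let σ-distinct , |σ| = ∈-S⁻ (suc m) σ∈
      m+1∈σ = max∈ σ-distinct |σ|
      σ↭ = ∈⇒↭-remove m+1∈σ
  in lose (∈-S⁺ (DistinctIn-∷⁻ (DistinctIn-resp-↭ σ↭ σ-distinct))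
                (ℕ.suc-injective (trans (sym (↭.↭-length σ↭)) |σ|)))
          (∈-insertions-remove σ m+1∈σ)

∈-S-suc⁺ : ∀ m {σ τ} → τ ∈ S m → σ ∈ insertions (suc m) τ → σ ∈ S (suc m)
∈-S-suc⁺ m {τ = τ} τ∈ σ∈ =
  let τ-distinct , |τ| = ∈-S⁻ m τ∈
      σ↭ = ∈-insertions⇒↭ τ σ∈
  in ∈-S⁺ (DistinctIn-resp-↭ (↭-sym σ↭) (DistinctIn-∷⁺ τ-distinct))
          (trans (↭.↭-length σ↭) (cong suc |τ|))

S-suc↭ : ∀ m → S (suc m) ↭ concatMap (insertions (suc m)) (S m)
S-suc↭ m = ∼bag⇒↭ (unique∧set⇒bag (S-unique (suc m)) insertions-S-unique
  (mk⇔ (∈-concatMap⁺ (insertions (suc m)) ∘ ∈-S-suc⁻ m)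
       λ σ∈ → let τ , τ∈ , σ∈′ = find (∈-concatMap⁻ (insertions (suc m)) {xs = S m} σ∈)
              in ∈-S-suc⁺ m τ∈ σ∈′))
  where
  m+1∉ : ∀ {τ} → τ ∈ S m → suc m ∉ τ
  m+1∉ τ∈ = suc∉ (proj₂ (proj₁ (∈-S⁻ m τ∈)))
  insertions-S-unique : Unique (concatMap (insertions (suc m)) (S m))
  insertions-S-unique = concatMap-unique (insertions (suc m)) (S-unique m)
    (λ τ∈ → insertions-unique _ (m+1∉ τ∈))
    λ τ∈ τ′∈ σ∈ σ∈′ →
      trans (sym (remove-insertions _ (m+1∉ τ∈) σ∈)) (remove-insertions _ (m+1∉ τ′∈) σ∈′)

-- Even letters, ascents and descents

ind : Bool → ℕ
ind b = if b then 1 else 0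

evens : List ℕ → ℕ
evens σ = sum (map (ind ∘ even) σ)

evens-↭ : ∀ {σ σ′} → σ ↭ σ′ → evens σ ≡ evens σ′
evens-↭ σ↭σ′ = sum-↭ (↭.map⁺ (ind ∘ even) σ↭σ′)

⌊suc/2⌋ : ∀ m → ⌊ suc m /2⌋ ≡ ind (even (suc m)) + ⌊ m /2⌋
⌊suc/2⌋ zero          = refl
⌊suc/2⌋ (suc zero)    = refl
⌊suc/2⌋ (suc (suc m)) =
  trans (cong suc (⌊suc/2⌋ m)) (sym (ℕ.+-suc (ind (even (suc m))) ⌊ m /2⌋))

evens-S : ∀ m {σ} → σ ∈ S m → evens σ ≡ ⌊ m /2⌋
evens-S zero    {[]}    σ∈ = refl
evens-S zero    {a ∷ σ} σ∈ with () ← proj₂ (∈-S⁻ 0 σ∈)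
evens-S (suc m) {σ}     σ∈ =
  let τ , τ∈ , σ∈′ = find (∈-S-suc⁻ m σ∈) in
  trans (evens-↭ (∈-insertions⇒↭ τ σ∈′))
    (trans (cong (_+_ (ind (even (suc m)))) (evens-S m τ∈)) (sym (⌊suc/2⌋ m)))

asc : List ℕ → ℕ
asc (a ∷ b ∷ σ) = ind ((a <ᵇ b) ∧ even b) + asc (b ∷ σ)
asc _           = 0

<ᵇ-true : ∀ {a b} → a < b → (a <ᵇ b) ≡ true
<ᵇ-true {a} {b} a<b with a <ᵇ b | ℕ.<ᵇ-reflects-< a b
... | true  | _        = refl
... | false | ofⁿ a≮b = contradiction a<b a≮b

<ᵇ-false : ∀ {a b} → b ≤ a → (a <ᵇ b) ≡ false
<ᵇ-false {a} {b} b≤a with a <ᵇ b | ℕ.<ᵇ-reflects-< a b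
... | false | _        = refl
... | true  | ofʸ a<b = contradiction b≤a (ℕ.<⇒≱ a<b)

ind-split : ∀ {a b} e → a ≢ b → ind ((a <ᵇ b) ∧ e) + ind ((b <ᵇ a) ∧ e) ≡ ind e
ind-split {a} {b} e a≢b with ℕ.<-cmp a b
... | tri< a<b _ _ rewrite <ᵇ-true a<b | <ᵇ-false (ℕ.<⇒≤ a<b) = ℕ.+-identityʳ (ind e)
... | tri≈ _ a≡b _ = contradiction a≡b a≢b
... | tri> _ _ b<a rewrite <ᵇ-false (ℕ.<⇒≤ b<a) | <ᵇ-true b<a = refl

asc+desE : ∀ a σ → Unique (a ∷ σ) → asc (a ∷ σ) + desE (a ∷ σ) ≡ evens σ
asc+desE a []      _                       = refl
asc+desE a (b ∷ σ) ((a≢b ∷ _) ∷ bσ-unique) =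
  trans (+-interchange (ind ((a <ᵇ b) ∧ even b)) (asc (b ∷ σ))
                       (ind ((b <ᵇ a) ∧ even b)) (desE (b ∷ σ)))
        (cong₂ _+_ (ind-split (even b) a≢b) (asc+desE b σ bσ-unique))

toℕ-chi : ∀ a σ → toℕ (chi (a ∷ σ)) ≡ ind (even a)
toℕ-chi a σ with even a
... | true  = refl
... | false = refl

chi+asc+desE : ∀ σ → Unique σ → toℕ (chi σ) + (asc σ + desE σ) ≡ evens σ
chi+asc+desE []      _        = refl
chi+asc+desE (a ∷ σ) σ-unique = cong₂ _+_ (toℕ-chi a σ) (asc+desE a σ σ-unique)

-- _≈P_, _+P_ and 0P are definitionally the pointwise lifts of ℤ's (_+_, 0).
+P-0P-commutativeMonoid : CommutativeMonoid _ _
+P-0P-commutativeMonoid =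
  Pointwise.commutativeMonoid ℕ (Pointwise.commutativeMonoid (Fin 2) ℤ.+-0-commutativeMonoid)

open CommutativeMonoid +P-0P-commutativeMonoid
  using (isCommutativeMonoid)
  renaming (setoid to Poly-setoid; refl to ≈P-refl; sym to ≈P-sym; trans to ≈P-trans
           ; assoc to +P-assoc; identityˡ to +P-identityˡ)
open CommSemigroupProperties (CommutativeMonoid.commutativeSemigroup +P-0P-commutativeMonoid)
  using () renaming (interchange to +P-interchange)

+P-cong : ∀ {p p′ q q′} → p ≈P p′ → q ≈P q′ → (p +P q) ≈P (p′ +P q′)
+P-cong p≈p′ q≈q′ k j = cong₂ _+ℤ_ (p≈p′ k j) (q≈q′ k j)

≡⇒≈P : ∀ {p q} → p ≡ q → p ≈P q
≡⇒≈P refl = ≈P-refl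

+P-congˡ : ∀ p {q q′} → q ≈P q′ → (p +P q) ≈P (p +P q′)
+P-congˡ p = +P-cong {p} ≈P-refl

Σ : {A : Set} → (A → Poly) → List A → Poly
Σ f = foldr (λ a acc → f a +P acc) 0P

Σ-map : {A B : Set} (f : B → Poly) (g : A → B) (xs : List A) → Σ f (map g xs) ≈P Σ (f ∘ g) xs
Σ-map f g xs k j = cong (λ p → p k j) (List.foldr-map (λ a acc → f a +P acc) g 0P xs)

Σ-↭ : {A : Set} (f : A → Poly) {xs ys : List A} → xs ↭ ys → Σ f xs ≈P Σ f ys
Σ-↭ f {xs} {ys} xs↭ys = begin
  Σ f xs                    ≈⟨ Σ-map (λ p → p) f xs ⟨
  foldr _+P_ 0P (map f xs)  ≈⟨ ↭ₛ.foldr-commMonoid Poly-setoid isCommutativeMonoid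
                                 (↭⇒↭ₛ′ (Setoid.isEquivalence Poly-setoid) (↭.map⁺ f xs↭ys)) ⟩
  foldr _+P_ 0P (map f ys)  ≈⟨ Σ-map (λ p → p) f ys ⟩
  Σ f ys                    ∎
  where open SetoidReasoning Poly-setoid

Σ-++ : {A : Set} (f : A → Poly) (xs ys : List A) → Σ f (xs ++ ys) ≈P (Σ f xs +P Σ f ys)
Σ-++ f []       ys = ≈P-sym (+P-identityˡ (Σ f ys))
Σ-++ f (x ∷ xs) ys =
  ≈P-trans (+P-congˡ (f x) (Σ-++ f xs ys)) (≈P-sym (+P-assoc (f x) (Σ f xs) (Σ f ys)))

Σ-concatMap : {A B : Set} (f : B → Poly) (g : A → List B) (xs : List A) →
              Σ f (concatMap g xs) ≈P Σ (Σ f ∘ g) xs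
Σ-concatMap f g []       = ≈P-refl
Σ-concatMap f g (x ∷ xs) =
  ≈P-trans (Σ-++ f (g x) (concatMap g xs)) (+P-congˡ (Σ f (g x)) (Σ-concatMap f g xs))

Σ-cong : {A : Set} {f g : A → Poly} (xs : List A) →
         (∀ {x} → x ∈ xs → f x ≈P g x) → Σ f xs ≈P Σ g xs
Σ-cong []       f≈g = ≈P-refl
Σ-cong (x ∷ xs) f≈g = +P-cong (f≈g (here refl)) (Σ-cong xs (f≈g ∘ there))

Additive : (Poly → Poly) → Set
Additive O = ∀ p q → O (p +P q) ≈P (O p +P O q)

-- 0P +P 0P computes to 0P, so additivity at (0P, 0P) says O 0P ≈P (O 0P +P O 0P).
additive⇒0P : ∀ O → Additive O → O 0P ≈P 0P
additive⇒0P O O-+ k j = ℤ-identityˡ-unique (O 0P k j) (O 0P k j) (sym (O-+ 0P 0P k j))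

Σ-additive : ∀ {A : Set} O → Additive O → (f : A → Poly) (xs : List A) →
             O (Σ f xs) ≈P Σ (O ∘ f) xs
Σ-additive O O-+ f []       = additive⇒0P O O-+
Σ-additive O O-+ f (x ∷ xs) =
  ≈P-trans (O-+ (f x) (Σ f xs)) (+P-congˡ (O (f x)) (Σ-additive O O-+ f xs))

infixl 25 _·P_ _⊙_

_·P_ : ℤ → Poly → Poly
(a ·P p) k j = a *ℤ p k j

_⊙_ : Poly → Poly → Poly
(w ⊙ p) k j = w k j *ℤ p k j

mulX : Poly → Poly
mulX p zero    j = + 0
mulX p (suc k) j = p k j

-- multiplication by z, truncated at z²
mulZ : Poly → Poly
mulZ p k #0        = + 0
mulZ p k (fsuc #0) = p k #0

∂z : Poly → Poly
∂z p k #0        = p k (fsuc #0)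
∂z p k (fsuc #0) = + 0

_⊕_ : (Poly → Poly) → (Poly → Poly) → Poly → Poly
(O₁ ⊕ O₂) p = O₁ p +P O₂ p

⊙-additive : ∀ w → Additive (w ⊙_)
⊙-additive w p q k j = ℤ.*-distribˡ-+ (w k j) (p k j) (q k j)

mulX-additive : Additive mulX
mulX-additive p q zero    j = refl
mulX-additive p q (suc k) j = refl

mulZ-additive : Additive mulZ
mulZ-additive p q k #0        = refl
mulZ-additive p q k (fsuc #0) = refl

∂z-additive : Additive ∂z
∂z-additive p q k #0        = refl
∂z-additive p q k (fsuc #0) = refl

mulX-cong : ∀ {p q} → p ≈P q → mulX p ≈P mulX q
mulX-cong p≈q zero    j = refl
mulX-cong p≈q (suc k) j = p≈q k j

⊕-additive : ∀ O₁ O₂ → Additive O₁ → Additive O₂ → Additive (O₁ ⊕ O₂)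
⊕-additive O₁ O₂ O₁-+ O₂-+ p q =
  ≈P-trans (+P-cong (O₁-+ p q) (O₂-+ p q)) (+P-interchange (O₁ p) (O₁ q) (O₂ p) (O₂ q))

mulX∘-additive : ∀ O → Additive O → Additive (mulX ∘ O)
mulX∘-additive O O-+ p q =
  ≈P-trans (mulX-cong (O-+ p q)) (mulX-additive (O p) (O q))

-- The operators Θ and Ω

θ-diag θ-sub : ℕ → Poly
θ-diag n k j = + n +ℤ + k +ℤ + 1
θ-sub n k #0        = + n -ℤ + k
θ-sub n k (fsuc #0) = + n -ℤ + k -ℤ + 1

-- Θ′ n = (n + 1 + x∂ₓ) + x (n − x∂ₓ − z∂_z + ∂_z)
Θ′ : ℕ → Poly → Poly
Θ′ n = (θ-diag n ⊙_) ⊕ (mulX ∘ ((θ-sub n ⊙_) ⊕ ∂z))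

Θ≈Θ′ : ∀ n p → Θ n p ≈P Θ′ n p
Θ≈Θ′ n p zero    #0        = sym (ℤ.+-identityʳ ((θ-diag n ⊙ p) zero #0))
Θ≈Θ′ n p zero    (fsuc #0) = sym (ℤ.+-identityʳ ((θ-diag n ⊙ p) zero (fsuc #0)))
Θ≈Θ′ n p (suc k) #0        =
  ℤ.+-assoc ((θ-diag n ⊙ p) (suc k) #0) ((θ-sub n ⊙ p) k #0) (p k (fsuc #0))
Θ≈Θ′ n p (suc k) (fsuc #0) =
  cong ((θ-diag n ⊙ p) (suc k) (fsuc #0) +ℤ_) (sym (ℤ.+-identityʳ ((θ-sub n ⊙ p) k (fsuc #0))))

Θ′-additive : ∀ n → Additive (Θ′ n)
Θ′-additive n =
  ⊕-additive (θ-diag n ⊙_) _ (⊙-additive (θ-diag n))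
    (mulX∘-additive _ (⊕-additive (θ-sub n ⊙_) ∂z (⊙-additive (θ-sub n)) ∂z-additive))

ω-diag ω-sub : ℕ → Poly
ω-diag n k #0        = + n +ℤ + k +ℤ + 1
ω-diag n k (fsuc #0) = + n +ℤ + k +ℤ + 2
ω-sub n k j = + n -ℤ + k

-- Ω′ n = z + (n + 1 + x∂ₓ + z∂_z) + x (n − x∂ₓ), with z² = 0
Ω′ : ℕ → Poly → Poly
Ω′ n = (mulZ ⊕ (ω-diag n ⊙_)) ⊕ (mulX ∘ (ω-sub n ⊙_))

Ω≈Ω′ : ∀ n p → Ω n p ≈P Ω′ n p
Ω≈Ω′ n p zero    #0        =
  sym (trans (ℤ.+-identityʳ (+ 0 +ℤ (ω-diag n ⊙ p) zero #0))
             (ℤ.+-identityˡ ((ω-diag n ⊙ p) zero #0)))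
Ω≈Ω′ n p zero    (fsuc #0) = sym (ℤ.+-identityʳ (p zero #0 +ℤ (ω-diag n ⊙ p) zero (fsuc #0)))
Ω≈Ω′ n p (suc k) #0        =
  cong (_+ℤ (ω-sub n ⊙ p) k #0) (sym (ℤ.+-identityˡ ((ω-diag n ⊙ p) (suc k) #0)))
Ω≈Ω′ n p (suc k) (fsuc #0) = refl

Ω′-additive : ∀ n → Additive (Ω′ n)
Ω′-additive n =
  ⊕-additive (mulZ ⊕ (ω-diag n ⊙_)) _ (⊕-additive mulZ _ mulZ-additive (⊙-additive (ω-diag n)))
    (mulX∘-additive (ω-sub n ⊙_) (⊙-additive (ω-sub n)))

mono-offˣ : ∀ {D k} c j → D ≢ k → mono D c k j ≡ + 0
mono-offˣ {D} {k} c j D≢k with D ≟ k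
... | yes D≡k = contradiction D≡k D≢k
... | no _    = refl

mono-offᶻ : ∀ D k {c j} → c ≢ j → mono D c k j ≡ + 0
mono-offᶻ D k {c} {j} c≢j with D ≟ k | c Fin.≟ j
... | _     | yes c≡j = contradiction c≡j c≢j
... | yes _ | no _    = refl
... | no _  | no _    = refl

mono-diag : ∀ D c → mono D c D c ≡ + 1
mono-diag D c with D ≟ D | c Fin.≟ c
... | yes _  | yes _  = refl
... | no D≢D | _      = contradiction refl D≢D
... | yes _  | no c≢c = contradiction refl c≢c

mono-suc : ∀ D c k j → mono (suc D) c (suc k) j ≡ mono D c k j
mono-suc D c k j = by-cases (D ≟ k) (c Fin.≟ j)
  where
  by-cases : Dec (D ≡ k) → Dec (c ≡ j) → mono (suc D) c (suc k) j ≡ mono D c k j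
  by-cases (no D≢k)  _         =
    trans (mono-offˣ c j (D≢k ∘ ℕ.suc-injective)) (sym (mono-offˣ c j D≢k))
  by-cases (yes _)   (no c≢j)  = trans (mono-offᶻ (suc D) (suc k) c≢j) (sym (mono-offᶻ D k c≢j))
  by-cases (yes D≡k) (yes c≡j) =
    subst₂ (λ k j → mono (suc D) c (suc k) j ≡ mono D c k j) D≡k c≡j
      (trans (mono-diag (suc D) c) (sym (mono-diag D c)))

⊙-mono : ∀ w D c → (w ⊙ mono D c) ≈P (w D c ·P mono D c)
⊙-mono w D c k j with D ≟ k | c Fin.≟ j
... | yes refl | yes refl = refl
... | yes refl | no _     = trans (ℤ.*-zeroʳ (w D j)) (sym (ℤ.*-zeroʳ (w D c)))
... | no _     | _        = trans (ℤ.*-zeroʳ (w k j)) (sym (ℤ.*-zeroʳ (w D c)))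

·P-congˡ : ∀ a {p q} → p ≈P q → (a ·P p) ≈P (a ·P q)
·P-congˡ a p≈q k j = cong (a *ℤ_) (p≈q k j)

mulX-· : ∀ a p → mulX (a ·P p) ≈P (a ·P mulX p)
mulX-· a p zero    j = sym (ℤ.*-zeroʳ a)
mulX-· a p (suc k) j = refl

mulX-mono : ∀ D c → mulX (mono D c) ≈P mono (suc D) c
mulX-mono D c zero    j = refl
mulX-mono D c (suc k) j = sym (mono-suc D c k j)

∂z-mono-#0 : ∀ D → ∂z (mono D #0) ≈P 0P
∂z-mono-#0 D k #0        = mono-offᶻ D k λ ()
∂z-mono-#0 D k (fsuc #0) = refl

∂z-mono-#1 : ∀ D → ∂z (mono D (fsuc #0)) ≈P mono D #0
∂z-mono-#1 D k #0 with D ≟ k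
... | yes _ = refl
... | no _  = refl
∂z-mono-#1 D k (fsuc #0) = sym (mono-offᶻ D k λ ())

mulZ-mono-#0 : ∀ D → mulZ (mono D #0) ≈P mono D (fsuc #0)
mulZ-mono-#0 D k #0 = sym (mono-offᶻ D k λ ())
mulZ-mono-#0 D k (fsuc #0) with D ≟ k
... | yes _ = refl
... | no _  = refl

mulZ-mono-#1 : ∀ D → mulZ (mono D (fsuc #0)) ≈P 0P
mulZ-mono-#1 D k #0        = refl
mulZ-mono-#1 D k (fsuc #0) = mono-offᶻ D k λ ()

Θ′-mono : ∀ n D c → Θ′ n (mono D c)
          ≈P (θ-diag n D c ·P mono D c +P (θ-sub n D c ·P mono (suc D) c +P mulX (∂z (mono D c))))
Θ′-mono n D c = +P-cong (⊙-mono (θ-diag n) D c)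
  (≈P-trans (mulX-additive (θ-sub n ⊙ mono D c) (∂z (mono D c)))
    (+P-cong (≈P-trans (mulX-cong (⊙-mono (θ-sub n) D c))
                (≈P-trans (mulX-· (θ-sub n D c) (mono D c))
                          (·P-congˡ (θ-sub n D c) (mulX-mono D c))))
             ≈P-refl))

Ω′-mono : ∀ n D c → Ω′ n (mono D c)
          ≈P ((mulZ (mono D c) +P ω-diag n D c ·P mono D c) +P ω-sub n D c ·P mono (suc D) c)
Ω′-mono n D c = +P-cong (+P-congˡ (mulZ (mono D c)) (⊙-mono (ω-diag n) D c))
  (≈P-trans (mulX-cong (⊙-mono (ω-sub n) D c))
    (≈P-trans (mulX-· (ω-sub n D c) (mono D c)) (·P-congˡ (ω-sub n D c) (mulX-mono D c))))

Θ′-insertion : ∀ {n c z} A D → z ≡ #0 → toℕ c + (A + D) ≡ n →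
  (mono (toℕ c + D) z +P ((+ (n + n) -ℤ + A) ·P mono D c +P (+ A) ·P mono (suc D) c))
  ≈P Θ′ n (mono D c)
Θ′-insertion {c = #0} A D refl refl =
  ≈P-sym (≈P-trans (Θ′-mono n D #0)
    (≈P-trans (+P-congˡ (θ-diag n D #0 ·P mono D #0)
                (+P-congˡ (θ-sub n D #0 ·P mono (suc D) #0) mulX∂z-mono))
      λ k j → arith (mono D #0 k j) (mono (suc D) #0 k j)))
  where
  n = A + D
  mulX∂z-mono : mulX (∂z (mono D #0)) ≈P 0P
  mulX∂z-mono = ≈P-trans (mulX-cong (∂z-mono-#0 D)) (additive⇒0P mulX mulX-additive)
  ring : ∀ a d u v → ((a +ℤ d) +ℤ d +ℤ + 1) *ℤ u +ℤ (((a +ℤ d) -ℤ d) *ℤ v +ℤ + 0)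
                     ≡ u +ℤ (((a +ℤ d) +ℤ (a +ℤ d) -ℤ a) *ℤ u +ℤ a *ℤ v)
  ring = solve-∀
  arith : ∀ u v → (+ n +ℤ + D +ℤ + 1) *ℤ u +ℤ ((+ n -ℤ + D) *ℤ v +ℤ + 0)
                  ≡ u +ℤ ((+ (n + n) -ℤ + A) *ℤ u +ℤ (+ A) *ℤ v)
  arith u v rewrite ℤ.pos-+ n n | ℤ.pos-+ A D = ring (+ A) (+ D) u v
Θ′-insertion {c = fsuc #0} A D refl refl =
  ≈P-sym (≈P-trans (Θ′-mono n D (fsuc #0))
    (≈P-trans (+P-congˡ (θ-diag n D (fsuc #0) ·P mono D (fsuc #0))
                (+P-congˡ (θ-sub n D (fsuc #0) ·P mono (suc D) (fsuc #0)) mulX∂z-mono))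
      λ k j → arith (mono D (fsuc #0) k j) (mono (suc D) (fsuc #0) k j) (mono (suc D) #0 k j)))
  where
  n = suc (A + D)
  mulX∂z-mono : mulX (∂z (mono D (fsuc #0))) ≈P mono (suc D) #0
  mulX∂z-mono = ≈P-trans (mulX-cong (∂z-mono-#1 D)) (mulX-mono D #0)
  ring : ∀ a d u v w →
    ((+ 1 +ℤ (a +ℤ d)) +ℤ d +ℤ + 1) *ℤ u +ℤ (((+ 1 +ℤ (a +ℤ d)) -ℤ d -ℤ + 1) *ℤ v +ℤ w)
    ≡ w +ℤ (((+ 1 +ℤ (a +ℤ d)) +ℤ (+ 1 +ℤ (a +ℤ d)) -ℤ a) *ℤ u +ℤ a *ℤ v)
  ring = solve-∀
  arith : ∀ u v w → (+ n +ℤ + D +ℤ + 1) *ℤ u +ℤ ((+ n -ℤ + D -ℤ + 1) *ℤ v +ℤ w)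
                    ≡ w +ℤ ((+ (n + n) -ℤ + A) *ℤ u +ℤ (+ A) *ℤ v)
  arith u v w rewrite ℤ.pos-+ n n | ℤ.pos-+ 1 (A + D) | ℤ.pos-+ A D =
    ring (+ A) (+ D) u v w

Ω′-insertion : ∀ {n c z} A D → z ≡ fsuc #0 → toℕ c + (A + D) ≡ n →
  (mono (toℕ c + D) z +P ((+ suc (n + n) -ℤ + A) ·P mono D c +P (+ A) ·P mono (suc D) c))
  ≈P Ω′ n (mono D c)
Ω′-insertion {c = #0} A D refl refl =
  ≈P-sym (≈P-trans (Ω′-mono n D #0)
    (≈P-trans (+P-cong (+P-cong (mulZ-mono-#0 D) ≈P-refl) ≈P-refl)
      λ k j → arith (mono D #0 k j) (mono (suc D) #0 k j) (mono D (fsuc #0) k j)))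
  where
  n = A + D
  ring : ∀ a d u v w → (w +ℤ ((a +ℤ d) +ℤ d +ℤ + 1) *ℤ u) +ℤ ((a +ℤ d) -ℤ d) *ℤ v
                       ≡ w +ℤ ((+ 1 +ℤ ((a +ℤ d) +ℤ (a +ℤ d)) -ℤ a) *ℤ u +ℤ a *ℤ v)
  ring = solve-∀
  arith : ∀ u v w → (w +ℤ (+ n +ℤ + D +ℤ + 1) *ℤ u) +ℤ (+ n -ℤ + D) *ℤ v
                    ≡ w +ℤ ((+ suc (n + n) -ℤ + A) *ℤ u +ℤ (+ A) *ℤ v)
  arith u v w rewrite ℤ.pos-+ 1 (n + n) | ℤ.pos-+ n n | ℤ.pos-+ A D = ring (+ A) (+ D) u v w
Ω′-insertion {c = fsuc #0} A D refl refl =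
  ≈P-sym (≈P-trans (Ω′-mono n D (fsuc #0))
    (≈P-trans (+P-cong (+P-cong (mulZ-mono-#1 D) ≈P-refl) ≈P-refl)
      λ k j → arith (mono D (fsuc #0) k j) (mono (suc D) (fsuc #0) k j)))
  where
  n = suc (A + D)
  ring : ∀ a d u v →
    (+ 0 +ℤ ((+ 1 +ℤ (a +ℤ d)) +ℤ d +ℤ + 2) *ℤ u) +ℤ ((+ 1 +ℤ (a +ℤ d)) -ℤ d) *ℤ v
    ≡ v +ℤ ((+ 1 +ℤ ((+ 1 +ℤ (a +ℤ d)) +ℤ (+ 1 +ℤ (a +ℤ d))) -ℤ a) *ℤ u +ℤ a *ℤ v)
  ring = solve-∀
  arith : ∀ u v → (+ 0 +ℤ (+ n +ℤ + D +ℤ + 2) *ℤ u) +ℤ (+ n -ℤ + D) *ℤ v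
                  ≡ v +ℤ ((+ suc (n + n) -ℤ + A) *ℤ u +ℤ (+ A) *ℤ v)
  arith u v rewrite ℤ.pos-+ 1 (n + n) | ℤ.pos-+ n n | ℤ.pos-+ 1 (A + D) | ℤ.pos-+ A D =
    ring (+ A) (+ D) u v

-- Inserting the largest letter

monomial : List ℕ → Poly
monomial σ = mono (desE σ) (chi σ)

front-absorb : ∀ e L A D (f : ℕ → Poly) →
  (f (ind e + D) +P ((+ L -ℤ + A) ·P f D +P (+ A) ·P f (suc D)))
  ≈P ((+ suc L -ℤ + (ind e + A)) ·P f D +P (+ (ind e + A)) ·P f (suc D))
front-absorb false L A D f k j rewrite ℤ.pos-+ 1 L = ring (+ L) (+ A) (f D k j) (f (suc D) k j)
  where
  ring : ∀ l a u v → u +ℤ ((l -ℤ a) *ℤ u +ℤ a *ℤ v) ≡ (+ 1 +ℤ l -ℤ a) *ℤ u +ℤ a *ℤ v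
  ring = solve-∀
front-absorb true  L A D f k j rewrite ℤ.pos-+ 1 L | ℤ.pos-+ 1 A =
  ring (+ L) (+ A) (f D k j) (f (suc D) k j)
  where
  ring : ∀ l a u v → v +ℤ ((l -ℤ a) *ℤ u +ℤ a *ℤ v)
                     ≡ (+ 1 +ℤ l -ℤ (+ 1 +ℤ a)) *ℤ u +ℤ (+ 1 +ℤ a) *ℤ v
  ring = solve-∀

desE-max-front : ∀ {x} a b σ → a < x → b < x → a ≢ b →
  desE (a ∷ x ∷ b ∷ σ) ≡ ind ((a <ᵇ b) ∧ even b) + desE (a ∷ b ∷ σ)
desE-max-front {x} a b σ a<x b<x a≢b rewrite <ᵇ-false {x} (ℕ.<⇒≤ a<x) | <ᵇ-true b<x =
  trans (cong (_+ desE (b ∷ σ)) (sym (ind-split (even b) a≢b)))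
        (ℕ.+-assoc (ind ((a <ᵇ b) ∧ even b)) (ind ((b <ᵇ a) ∧ even b)) (desE (b ∷ σ)))

insertions-after-head : ∀ {x} a τ → All (_< x) (a ∷ τ) → Unique (a ∷ τ) → (f : ℕ → Poly) →
  Σ (λ σ → f (desE (a ∷ σ))) (insertions x τ)
  ≈P ((+ suc (length τ) -ℤ + asc (a ∷ τ)) ·P f (desE (a ∷ τ))
      +P (+ asc (a ∷ τ)) ·P f (suc (desE (a ∷ τ))))
insertions-after-head {x} a [] (a<x ∷ []) _ f k j rewrite <ᵇ-false {x} (ℕ.<⇒≤ a<x) =
  ring (f 0 k j) (f 1 k j)
  where
  ring : ∀ u v → u +ℤ + 0 ≡ (+ 1 -ℤ + 0) *ℤ u +ℤ + 0 *ℤ v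
  ring = solve-∀
insertions-after-head {x} a (b ∷ σ) (a<x ∷ b<x ∷ σ<x) ((a≢b ∷ _) ∷ bσ-unique) f = begin
    (f (desE (a ∷ x ∷ b ∷ σ)) +P Σ (λ σ′ → f (desE (a ∷ σ′))) (map (b ∷_) (insertions x σ)))
  ≈⟨ +P-cong (≡⇒≈P (cong f (desE-max-front a b σ a<x b<x a≢b)))
             (Σ-map (λ σ′ → f (desE (a ∷ σ′))) (b ∷_) (insertions x σ)) ⟩
    (f (α + D) +P Σ (λ σ′ → f (δ + desE (b ∷ σ′))) (insertions x σ))
  ≈⟨ +P-congˡ (f (α + D)) (insertions-after-head b σ (b<x ∷ σ<x) bσ-unique (f ∘ _+_ δ)) ⟩
    (f (α + D) +P ((+ L -ℤ + A) ·P f D +P (+ A) ·P f (δ + suc (desE (b ∷ σ)))))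
  ≈⟨ +P-congˡ (f (α + D)) (+P-congˡ ((+ L -ℤ + A) ·P f D)
       (·P-congˡ (+ A) (≡⇒≈P (cong f (ℕ.+-suc δ (desE (b ∷ σ))))))) ⟩
    (f (α + D) +P ((+ L -ℤ + A) ·P f D +P (+ A) ·P f (suc D)))
  ≈⟨ front-absorb ((a <ᵇ b) ∧ even b) L A D f ⟩
    ((+ suc L -ℤ + (α + A)) ·P f D +P (+ (α + A)) ·P f (suc D))
  ∎
  where
  open SetoidReasoning Poly-setoid
  α δ D A L : ℕ
  α = ind ((a <ᵇ b) ∧ even b)
  δ = ind ((b <ᵇ a) ∧ even b)
  D = desE (a ∷ b ∷ σ)
  A = asc (b ∷ σ)
  L = suc (length σ)

insertions-sum : ∀ x τ → All (_< x) τ → Unique τ →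
  Σ monomial (insertions x τ)
  ≈P (mono (toℕ (chi τ) + desE τ) (chi (x ∷ []))
      +P ((+ length τ -ℤ + asc τ) ·P monomial τ +P (+ asc τ) ·P mono (suc (desE τ)) (chi τ)))
insertions-sum x [] _ _ k j = ring (mono 0 (chi (x ∷ [])) k j) (mono 0 #0 k j) (mono 1 #0 k j)
  where
  ring : ∀ u v w → u +ℤ + 0 ≡ u +ℤ ((+ 0 -ℤ + 0) *ℤ v +ℤ + 0 *ℤ w)
  ring = solve-∀
insertions-sum x (a ∷ τ) (a<x ∷ τ<x) aτ-unique =
  +P-cong (≡⇒≈P (cong (λ d → mono d (chi (x ∷ []))) front))
    (≈P-trans (Σ-map monomial (a ∷_) (insertions x τ))
      (insertions-after-head a τ (a<x ∷ τ<x) aτ-unique (λ d → mono d (chi (a ∷ τ)))))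
  where
  front : desE (x ∷ a ∷ τ) ≡ toℕ (chi (a ∷ τ)) + desE (a ∷ τ)
  front rewrite <ᵇ-true a<x = cong (_+ desE (a ∷ τ)) (sym (toℕ-chi a τ))

insertions-sum-S : ∀ m {τ} → τ ∈ S m →
  Σ monomial (insertions (suc m) τ)
  ≈P (mono (toℕ (chi τ) + desE τ) (chi (suc m ∷ []))
      +P ((+ m -ℤ + asc τ) ·P monomial τ +P (+ asc τ) ·P mono (suc (desE τ)) (chi τ)))
insertions-sum-S m {τ} τ∈ with (τ-unique , τ-in) , refl ← ∈-S⁻ m τ∈ =
  insertions-sum (suc m) τ (All.map (s≤s ∘ proj₂) τ-in) τ-unique

chi+asc+desE-S : ∀ m {τ} → τ ∈ S m → toℕ (chi τ) + (asc τ + desE τ) ≡ ⌊ m /2⌋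
chi+asc+desE-S m {τ} τ∈ = trans (chi+asc+desE τ (proj₁ (proj₁ (∈-S⁻ m τ∈)))) (evens-S m τ∈)

P-suc : ∀ m O → Additive O →
  (∀ {τ} → τ ∈ S m → Σ monomial (insertions (suc m) τ) ≈P O (monomial τ)) →
  P (suc m) ≈P O (P m)
P-suc m O O-+ per-τ = begin
  Σ monomial (S (suc m))                             ≈⟨ Σ-↭ monomial (S-suc↭ m) ⟩
  Σ monomial (concatMap (insertions (suc m)) (S m))  ≈⟨ Σ-concatMap monomial (insertions (suc m)) (S m) ⟩
  Σ (Σ monomial ∘ insertions (suc m)) (S m)          ≈⟨ Σ-cong (S m) per-τ ⟩
  Σ (O ∘ monomial) (S m)                             ≈⟨ Σ-additive O O-+ monomial (S m) ⟨
  O (P m)                                            ∎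
  where open SetoidReasoning Poly-setoid

even-double : ∀ n → even (n + n) ≡ true
even-double zero    = refl
even-double (suc n) rewrite ℕ.+-suc n n = even-double n

odd-double : ∀ n → even (suc (n + n)) ≡ false
odd-double zero    = refl
odd-double (suc n) rewrite ℕ.+-suc n n = odd-double n

P-odd : ∀ n → P (suc (n + n)) ≈P Θ n (P (n + n))
P-odd n = ≈P-trans (P-suc (n + n) (Θ′ n) (Θ′-additive n) per-τ) (≈P-sym (Θ≈Θ′ n (P (n + n))))
  where
  per-τ : ∀ {τ} → τ ∈ S (n + n) → Σ monomial (insertions (suc (n + n)) τ) ≈P Θ′ n (monomial τ)
  per-τ {τ} τ∈ = ≈P-trans (insertions-sum-S (n + n) τ∈)
    (Θ′-insertion (asc τ) (desE τ) (cong (λ b → if b then fsuc #0 else #0) (odd-double n))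
      (trans (chi+asc+desE-S (n + n) τ∈) (sym (ℕ.n≡⌊n+n/2⌋ n))))

P-even : ∀ n → P (suc (suc (n + n))) ≈P Ω n (P (suc (n + n)))
P-even n =
  ≈P-trans (P-suc (suc (n + n)) (Ω′ n) (Ω′-additive n) per-τ) (≈P-sym (Ω≈Ω′ n (P (suc (n + n)))))
  where
  per-τ : ∀ {τ} → τ ∈ S (suc (n + n)) →
          Σ monomial (insertions (suc (suc (n + n))) τ) ≈P Ω′ n (monomial τ)
  per-τ {τ} τ∈ = ≈P-trans (insertions-sum-S (suc (n + n)) τ∈)
    (Ω′-insertion (asc τ) (desE τ) (cong (λ b → if b then fsuc #0 else #0) (even-double n))
      (trans (chi+asc+desE-S (suc (n + n)) τ∈) (sym (ℕ.n≡⌈n+n/2⌉ n))))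

P-1 : P 1 ≈P oneP
P-1 k j = ℤ.+-identityʳ (mono 0 #0 k j)

P-2 : P 2 ≈P onePlusZ
P-2 k j = cong (mono 0 #0 k j +ℤ_) (ℤ.+-identityʳ (mono 0 (fsuc #0) k j))

2*n≡n+n : ∀ n → 2 * n ≡ n + n
2*n≡n+n n = cong (_+_ n) (ℕ.+-identityʳ n)

theorem4p1 : (P 1 ≈P oneP) × (P 2 ≈P onePlusZ)
  × (∀ n → n ≥ 1 → P (2 * n + 1) ≈P Θ n (P (2 * n)))
  × (∀ n → n ≥ 1 → P (2 * n + 2) ≈P Ω n (P (2 * n + 1)))
theorem4p1 = P-1 , P-2 , odd-case , even-case
  where
  -- The recurrences hold for n = 0 too.
  odd-case : ∀ n → n ≥ 1 → P (2 * n + 1) ≈P Θ n (P (2 * n))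
  odd-case n _ rewrite ℕ.+-comm (2 * n) 1 | 2*n≡n+n n = P-odd n
  even-case : ∀ n → n ≥ 1 → P (2 * n + 2) ≈P Ω n (P (2 * n + 1))
  even-case n _ rewrite ℕ.+-comm (2 * n) 2 | ℕ.+-comm (2 * n) 1 | 2*n≡n+n n = P-even n
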